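{- Let $r\geq 3$ and $n\geq r$ be integers and let $H$ be an $r$-uniform hypergraph on $n$ vertices. If $\delta_1(H)>\binom{\lceil n/2\rceil-1}{r-1}$, then $H$ contains a weak Hamilton cycle.
   Context: $\delta_1(H)$ is the minimum, over vertices $v$, of the number of hyperedges containing $v$. A weak cycle is an alternating sequence $(v_1,e_1,v_2,\ldots,v_k,e_k)$ of distinct vertices $v_1,\ldots,v_k$ and (not necessarily distinct) hyperedges $e_1,\ldots,e_k$ such that $\{v_1,v_k\}\subseteq e_k$ and $\{v_i,v_{i+1}\}\subseteq e_i$ for every $i\in[k-1]$. A weak Hamilton cycle of a hypergraph on $n$ vertices is a weak cycle with $k=n$ (so it passes through all vertices). -}

module Defs where

open import Data.Nat using (ℕ; zero; suc; _≤_; _<_; _∸_)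
open import Data.Nat.Combinatorics using (_C_)
open import Data.Nat.Base using (⌈_/2⌉)
open import Data.Fin using (Fin; zero; suc; fromℕ<; toℕ)
open import Data.Nat.DivMod using (m%n<n)
open import Data.Fin.Subset using (Subset; _∈_; ∣_∣)
open import Data.Fin.Subset.Properties using (_∈?_)
open import Data.List using (List; length; filter)
open import Data.List.Relation.Unary.All using (All)
open import Data.List.Relation.Unary.Any using (Any)
open import Data.List.Relation.Unary.Unique.Propositional using (Unique)
open import Data.Fin.Permutation using (Permutation′; _⟨$⟩ʳ_)
open import Data.Product using (Σ; _×_; ∃)
open import Relation.Binary.PropositionalEquality using (_≡_)

record UniformHypergraph (r n : ℕ) : Set where
  field
    edges   : List (Subset n)
    unique  : Unique edges
    uniform : All (λ e → ∣ e ∣ ≡ r) edges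
open UniformHypergraph public

degree : ∀ {r n} → UniformHypergraph r n → Fin n → ℕ
degree H v = length (filter (λ e → v ∈? e) (edges H))

δ₁> : ∀ {r n} → UniformHypergraph r n → ℕ → Set
δ₁> H k = ∀ v → k < degree H v

next : ∀ {n} → Fin n → Fin n
next {suc m} i = fromℕ< (m%n<n (suc (toℕ i)) (suc m))

-- a weak Hamilton cycle: a cyclic ordering σ(0), …, σ(n-1) of all vertices
-- (σ a permutation, so the vertices are distinct and all appear) such that
-- each pair of consecutive vertices, including σ(n-1), σ(0), lies in a
-- common hyperedge (hyperedges need not be distinct).
WeakHamiltonCycle : ∀ {r n} → UniformHypergraph r n → Set
WeakHamiltonCycle {n = n} H =
  Σ (Permutation′ n) λ σ →
    ∀ (i : Fin n) → Any (λ e → (σ ⟨$⟩ʳ i) ∈ e × (σ ⟨$⟩ʳ next i) ∈ e) (edges H)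

-- Every hyperedge through v is an r-set containing v inside the closed neighbourhood N(v)
-- of v in the 2-shadow of H, and distinct such hyperedges stay distinct after deleting v.
-- Hence deg v ≤ C(|N(v)| - 1, r - 1), and the degree hypothesis forces |N(v) - v| ≥ ⌈n/2⌉:
-- the shadow graph satisfies Dirac's condition. Dirac's theorem, proved by Pósa reversals
-- that remove non-adjacent consecutive pairs from a cyclic ordering of the vertices, gives
-- a Hamilton cycle of the shadow; consecutive vertices on it share a hyperedge.

module Submission where

open import Defs
open import Data.Bool.Base using (Bool; if_then_else_)
import Data.Bool.Properties as Bool
open import Data.Fin.Base using (Fin; zero; suc; toℕ; fromℕ; fromℕ<; inject₁; lower₁; cast)
open import Data.Fin.Properties as Fin
  using (toℕ-injective; toℕ-fromℕ<; toℕ-inject₁; toℕ-fromℕ; toℕ<n; inject₁-lower₁)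
open import Data.Fin.Permutation using (Permutation; permutation; _⟨$⟩ʳ_; _∘ₚ_; cast-id)
open import Data.Fin.Subset using (Subset; inside; outside; _∈_; _∉_; _⊆_; ∣_∣; _-_; ⁅_⁆)
open import Data.Fin.Subset.Properties
  using (_∈?_; drop-∷-⊆; ⊆-antisym; ⊆-reflexive; p─⊥≡p; p─q⊆p; x∈p∧x≢y⇒x∈p-y)
open import Data.List.Base as List
  using (List; []; _∷_; [_]; _++_; _∷ʳ_; length; map; filter; reverse; tabulate; lookup; allFin)
open import Data.List.Properties
  using (++-assoc; ++-identityʳ; unfold-reverse; reverse-++; length-map; length-tabulate;
         length-filter; filter-accept; filter-reject)
import Data.List.Membership.Propositional as List
open import Data.List.Membership.Propositional.Properties using (∈-filter⁻; ∈-lookup; ∈-allFin)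
open import Data.List.Relation.Binary.Permutation.Propositional
  using (_↭_; ↭-refl; ↭-sym; ↭-trans; ↭-swap; ↭-reflexive; prep; ↭⇒↭ₛ)
open import Data.List.Relation.Binary.Permutation.Propositional.Properties
  using (++-comm; ++⁺ʳ; ↭-length; ↭-reverse; filter-↭; ∈-resp-↭)
open import Data.List.Relation.Binary.Permutation.Setoid.Properties using (Unique-resp-↭)
open import Data.List.Relation.Unary.All as All using (All; []; _∷_)
import Data.List.Relation.Unary.All.Properties as All
open import Data.List.Relation.Unary.Any as Any using (Any; here; there; index; any?)
open import Data.List.Relation.Unary.Any.Properties using (lookup-index)
open import Data.List.Relation.Unary.Linked using (Linked; []; [-]; _∷_)
open import Data.List.Relation.Unary.Unique.Propositional using (Unique; []; _∷_)
open import Data.List.Relation.Unary.Unique.Propositional.Properties using (allFin⁺; filter⁺)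
open import Data.Nat.Base hiding (∣_-_∣; _⊔_)
open import Data.Nat.Combinatorics using (_C_; nCk+nC[k+1]≡[n+1]C[k+1])
open import Data.Nat.DivMod using (_%_; m<n⇒m%n≡m; n%n≡0)
open import Data.Nat.Properties
open import Data.Nat.Tactic.RingSolver using (solve-∀)
open import Data.Product.Base using (∃-syntax; _×_; _,_; map₁; map₂; swap)
open import Data.Sum.Base using (_⊎_; inj₁; inj₂)
open import Data.Unit.Polymorphic.Base using (⊤)
open import Data.Vec.Base as Vec using ([]; _∷_; here; there)
open import Data.Vec.Properties using (lookup⇒[]=; lookup∘tabulate)
open import Function.Base using (id; _∘_)
open import Level using (Level; 0ℓ; _⊔_)
open import Relation.Binary.Core using (Rel)
open import Relation.Binary.Definitions using (Decidable; Symmetric; Reflexive)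
open import Relation.Binary.PropositionalEquality hiding ([_])
open import Relation.Nullary.Decidable using (yes; no; does; dec-true; dec-false; _×-dec_)
open import Relation.Nullary.Negation using (¬_; contradiction)
open import Relation.Unary using (Pred)
import Relation.Unary as U

private
  variable
    a ℓ : Level
    A B : Set a
    k m n : ℕ

nCk≤[1+n]Ck : ∀ n k → n C k ≤ suc n C k
nCk≤[1+n]Ck n zero    = ≤-refl
nCk≤[1+n]Ck n (suc k) =
  subst (n C suc k ≤_) (nCk+nC[k+1]≡[n+1]C[k+1] n k) (m≤n+m (n C suc k) (n C k))

C-monoˡ-≤ : ∀ k {m n} → m ≤ n → m C k ≤ n C k
C-monoˡ-≤ k = go ∘ ≤⇒≤′
  where
  go : ∀ {m n} → m ≤′ n → m C k ≤ n C k
  go ≤′-refl       = ≤-refl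
  go (≤′-step m≤n) = ≤-trans (go m≤n) (nCk≤[1+n]Ck _ k)

C-cancelˡ-< : ∀ k {m n} → m C k < n C k → m < n
C-cancelˡ-< k mCk<nCk = ≰⇒> λ n≤m → <⇒≱ mCk<nCk (C-monoˡ-≤ k n≤m)

m∸1<n⇒m≤n : ∀ {m n} → m ∸ 1 < n → m ≤ n
m∸1<n⇒m≤n {zero}  _   = z≤n
m∸1<n⇒m≤n {suc m} m<n = m<n

n+2≤2*[1+⌈n/2⌉] : ∀ n → n + 2 ≤ 2 * suc ⌈ n /2⌉
n+2≤2*[1+⌈n/2⌉] n = begin
  n + 2                      ≡⟨ cong (_+ 2) (⌊n/2⌋+⌈n/2⌉≡n n) ⟨
  ⌊ n /2⌋ + ⌈ n /2⌉ + 2      ≤⟨ +-monoˡ-≤ 2 (+-monoˡ-≤ ⌈ n /2⌉ (⌊n/2⌋≤⌈n/2⌉ n)) ⟩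
  ⌈ n /2⌉ + ⌈ n /2⌉ + 2      ≡⟨ double ⌈ n /2⌉ ⟩
  2 * suc ⌈ n /2⌉            ∎
  where
  open ≤-Reasoning
  double : ∀ c → c + c + 2 ≡ 2 * suc c
  double = solve-∀

≤-half-sum : ∀ {k x y} → k ≤ 2 * x → k ≤ 2 * y → k ≤ x + y
≤-half-sum {k} {x} {y} k≤2x k≤2y = *-cancelˡ-≤ 2 (begin
  2 * k          ≡⟨ cong (k +_) (+-identityʳ k) ⟩
  k + k          ≤⟨ +-mono-≤ k≤2x k≤2y ⟩
  2 * x + 2 * y  ≡⟨ *-distribˡ-+ 2 x y ⟨
  2 * (x + y)    ∎)
  where open ≤-Reasoning

-- Counting subsets

Unique-map⁺ : ∀ {P : Pred A ℓ} {f : A → B} →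
              (∀ {x y} → P x → P y → f x ≡ f y → x ≡ y) →
              ∀ {xs} → All P xs → Unique xs → Unique (map f xs)
Unique-map⁺ inj []         []         = []
Unique-map⁺ inj (px ∷ pxs) (x∉ ∷ uxs) =
  All.map⁺ (All.zipWith (λ (x≢y , py) → x≢y ∘ inj px py) (x∉ , pxs)) ∷ Unique-map⁺ inj pxs uxs

All-∅⇒length≡0 : ∀ {P : Pred A ℓ} → (∀ {x} → ¬ P x) → ∀ {xs} → All P xs → length xs ≡ 0
All-∅⇒length≡0 ¬P []       = refl
All-∅⇒length≡0 ¬P (px ∷ _) = contradiction px ¬P

tailsWith : Bool → List (Subset (suc n)) → List (Subset n)
tailsWith b [] = []
tailsWith b ((c ∷ e) ∷ es) with b Bool.≟ c
... | yes _ = e ∷ tailsWith b es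
... | no _  = tailsWith b es

∈-tailsWith⁻ : ∀ b {e} (es : List (Subset (suc n))) → e List.∈ tailsWith b es → (b ∷ e) List.∈ es
∈-tailsWith⁻ b ((c ∷ e) ∷ es) e∈ with b Bool.≟ c | e∈
... | yes refl | here refl = here refl
... | yes refl | there e∈′ = there (∈-tailsWith⁻ b es e∈′)
... | no _     | e∈′       = there (∈-tailsWith⁻ b es e∈′)

tailsWith-All : ∀ {P : Pred (Subset (suc n)) ℓ} b {es} → All P es → All (P ∘ (b ∷_)) (tailsWith b es)
tailsWith-All b {es} pes = All.tabulate (All.lookup pes ∘ ∈-tailsWith⁻ b es)

tailsWith-unique : ∀ b {es : List (Subset (suc n))} → Unique es → Unique (tailsWith b es)
tailsWith-unique b {[]}           []         = []
tailsWith-unique b {(c ∷ e) ∷ es} (e∉ ∷ ues) with b Bool.≟ c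
... | yes refl =
  All.tabulate (λ e′∈ e≡e′ → All.lookup e∉ (∈-tailsWith⁻ b es e′∈) (cong (b ∷_) e≡e′))
  ∷ tailsWith-unique b ues
... | no _     = tailsWith-unique b ues

tailsWith-⊆ : ∀ {P : Pred (Subset (suc n)) ℓ} b {s S es} → All (λ e → e ⊆ s ∷ S × P e) es →
              All (λ e → e ⊆ S × P (b ∷ e)) (tailsWith b es)
tailsWith-⊆ b pes = All.map (map₁ drop-∷-⊆) (tailsWith-All b pes)

length-tailsWith : ∀ (es : List (Subset (suc n))) →
                   length es ≡ length (tailsWith inside es) + length (tailsWith outside es)
length-tailsWith [] = refl
length-tailsWith ((inside ∷ e) ∷ es)  = cong suc (length-tailsWith es)
length-tailsWith ((outside ∷ e) ∷ es) =
  trans (cong suc (length-tailsWith es)) (sym (+-suc _ _))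

length-subsets≤C : ∀ (S : Subset n) {es} → Unique es → All (λ e → e ⊆ S × ∣ e ∣ ≡ k) es →
                   length es ≤ ∣ S ∣ C k
length-subsets≤C []            {[]}          _              _                  = z≤n
length-subsets≤C []            {[] ∷ []}     _              ((_ , refl) ∷ [])  = ≤-refl
length-subsets≤C []            {[] ∷ [] ∷ _} ((≢[] ∷ _) ∷ _) _                 = contradiction refl ≢[]
length-subsets≤C {k = k} (outside ∷ S) {es} ues pes = begin
  length es                 ≡⟨ length-tailsWith es ⟩
  length ins + length outs  ≡⟨ cong (_+ length outs) no-ins ⟩
  length outs               ≤⟨ length-subsets≤C S (tailsWith-unique outside ues) (tailsWith-⊆ outside pes) ⟩
  ∣ S ∣ C k                 ∎
  where
  open ≤-Reasoning
  ins  = tailsWith inside es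
  outs = tailsWith outside es
  no-ins : length ins ≡ 0
  no-ins = All-∅⇒length≡0 (λ (e⊆ , _) → contradiction (e⊆ here) λ ()) (tailsWith-All inside pes)
length-subsets≤C {k = zero} (inside ∷ S) {es} ues pes = begin
  length es                 ≡⟨ length-tailsWith es ⟩
  length ins + length outs  ≡⟨ cong (_+ length outs) no-ins ⟩
  length outs               ≤⟨ length-subsets≤C S (tailsWith-unique outside ues) (tailsWith-⊆ outside pes) ⟩
  ∣ S ∣ C 0                 ∎
  where
  open ≤-Reasoning
  ins  = tailsWith inside es
  outs = tailsWith outside es
  no-ins : length ins ≡ 0
  no-ins = All-∅⇒length≡0 (λ ()) (tailsWith-All inside pes)
length-subsets≤C {k = suc k} (inside ∷ S) {es} ues pes = begin
  length es                  ≡⟨ length-tailsWith es ⟩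
  length ins + length outs   ≤⟨ +-mono-≤ ins≤ outs≤ ⟩
  ∣ S ∣ C k + ∣ S ∣ C suc k  ≡⟨ nCk+nC[k+1]≡[n+1]C[k+1] ∣ S ∣ k ⟩
  suc ∣ S ∣ C suc k          ∎
  where
  open ≤-Reasoning
  ins  = tailsWith inside es
  outs = tailsWith outside es
  ins≤ : length ins ≤ ∣ S ∣ C k
  ins≤ = length-subsets≤C S (tailsWith-unique inside ues)
           (All.map (map₂ suc-injective) (tailsWith-⊆ inside pes))
  outs≤ : length outs ≤ ∣ S ∣ C suc k
  outs≤ = length-subsets≤C S (tailsWith-unique outside ues) (tailsWith-⊆ outside pes)

x∉p-x : ∀ (x : Fin n) p → x ∉ p - x
x∉p-x zero    (inside ∷ p)  ()
x∉p-x zero    (outside ∷ p) ()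
x∉p-x (suc x) (_ ∷ p)       (there x∈p-x) = x∉p-x x p x∈p-x

suc∣p-x∣≡∣p∣ : ∀ {x : Fin n} {p} → x ∈ p → suc ∣ p - x ∣ ≡ ∣ p ∣
suc∣p-x∣≡∣p∣ {p = inside ∷ p}              here        = cong (suc ∘ ∣_∣) (p─⊥≡p p)
suc∣p-x∣≡∣p∣ {x = suc x} {p = inside ∷ p}  (there x∈p) = cong suc (suc∣p-x∣≡∣p∣ x∈p)
suc∣p-x∣≡∣p∣ {x = suc x} {p = outside ∷ p} (there x∈p) = suc∣p-x∣≡∣p∣ x∈p

p⊆q⇒p-x⊆q-x : ∀ {x : Fin n} {p q} → p ⊆ q → p - x ⊆ q - x
p⊆q⇒p-x⊆q-x {x = x} {p} p⊆q {y} y∈p-x =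
  x∈p∧x≢y⇒x∈p-y (p⊆q (p─q⊆p p ⁅ x ⁆ y∈p-x)) λ { refl → x∉p-x x p y∈p-x }

p-x⊆q-x⇒p⊆q : ∀ {x : Fin n} {p q} → x ∈ q → p - x ⊆ q - x → p ⊆ q
p-x⊆q-x⇒p⊆q {x = x} {q = q} x∈q p-x⊆q-x {y} y∈p with y Fin.≟ x
... | yes refl = x∈q
... | no  y≢x  = p─q⊆p q ⁅ x ⁆ (p-x⊆q-x (x∈p∧x≢y⇒x∈p-y y∈p y≢x))

-x-injective : ∀ {x : Fin n} {p q} → x ∈ p → x ∈ q → p - x ≡ q - x → p ≡ q
-x-injective x∈p x∈q eq =
  ⊆-antisym (p-x⊆q-x⇒p⊆q x∈q (⊆-reflexive eq)) (p-x⊆q-x⇒p⊆q x∈p (⊆-reflexive (sym eq)))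

length-links≤C : ∀ (x : Fin n) S {es} → Unique es →
                 All (λ e → x ∈ e × e ⊆ S × ∣ e ∣ ≡ suc k) es → length es ≤ ∣ S - x ∣ C k
length-links≤C {k = k} x S {es} ues pes = begin
  length es                ≡⟨ length-map (_- x) es ⟨
  length (map (_- x) es)   ≤⟨ length-subsets≤C (S - x) unique-links links ⟩
  ∣ S - x ∣ C k            ∎
  where
  open ≤-Reasoning
  unique-links : Unique (map (_- x) es)
  unique-links = Unique-map⁺ (λ (x∈e , _) (x∈e′ , _) → -x-injective x∈e x∈e′) pes ues
  link : ∀ {e} → x ∈ e × e ⊆ S × ∣ e ∣ ≡ suc k → e - x ⊆ S - x × ∣ e - x ∣ ≡ k
  link (x∈e , e⊆S , ∣e∣≡1+k) = p⊆q⇒p-x⊆q-x e⊆S , suc-injective (trans (suc∣p-x∣≡∣p∣ x∈e) ∣e∣≡1+k)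
  links : All (λ e → e ⊆ S - x × ∣ e ∣ ≡ k) (map (_- x) es)
  links = All.map⁺ (All.map link pes)

-- Dirac's theorem

CyclicallyLinked : {A : Set a} → Rel A ℓ → List A → Set (a ⊔ ℓ)
CyclicallyLinked R []       = ⊤
CyclicallyLinked R (x ∷ xs) = Linked R (x ∷ xs ∷ʳ x)

Consecutive : Pred A ℓ → Pred A ℓ → List A → Set _
Consecutive P Q xs = ∃[ ws ] ∃[ w ] ∃[ w′ ] ∃[ ws′ ] xs ≡ ws ++ w ∷ w′ ∷ ws′ × P w × Q w′

Consecutive-∷ : ∀ {P Q : Pred A ℓ} x {xs} → Consecutive P Q xs → Consecutive P Q (x ∷ xs)
Consecutive-∷ x (ws , w , w′ , ws′ , eq , pw , qw′) = x ∷ ws , w , w′ , ws′ , cong (x ∷_) eq , pw , qw′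

consecutive-pigeonhole : ∀ {P Q : Pred A ℓ} (P? : U.Decidable P) (Q? : U.Decidable Q) x xs →
  length (x ∷ xs) < length (filter P? (x ∷ xs)) + length (filter Q? xs) →
  Consecutive P Q (x ∷ xs)
consecutive-pigeonhole P? Q? x [] 1<∣P∣ =
  contradiction (≤-trans 1<∣P∣ (≤-reflexive (+-identityʳ _))) (<⇒≱ (s≤s (length-filter P? [ x ])))
consecutive-pigeonhole P? Q? x (y ∷ ys) bound with P? x | Q? y
... | yes px | yes qy = [] , x , y , ys , refl , px , qy
... | yes _  | no _   = Consecutive-∷ x (consecutive-pigeonhole P? Q? y ys (s≤s⁻¹ bound))
... | no _   | yes _  =
  Consecutive-∷ x (consecutive-pigeonhole P? Q? y ys (s≤s⁻¹ (≤-trans bound (≤-reflexive (+-suc _ _)))))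
... | no _   | no _   = Consecutive-∷ x (consecutive-pigeonhole P? Q? y ys (≤-trans (n≤1+n _) bound))

module Dirac {V : Set} {_~_ : Rel V 0ℓ} (_~?_ : Decidable _~_)
             (~-sym : Symmetric _~_) (~-refl : Reflexive _~_) where

  gap : V → V → ℕ
  gap x y = if does (x ~? y) then 0 else 1

  gap-adjacent : ∀ {x y} → x ~ y → gap x y ≡ 0
  gap-adjacent {x} {y} x~y rewrite dec-true (x ~? y) x~y = refl

  gap-nonadjacent : ∀ {x y} → ¬ x ~ y → gap x y ≡ 1
  gap-nonadjacent {x} {y} x≁y rewrite dec-false (x ~? y) x≁y = refl

  gap≡0⇒adjacent : ∀ {x y} → gap x y ≡ 0 → x ~ y
  gap≡0⇒adjacent {x} {y} gap≡0 with x ~? y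
  ... | yes x~y = x~y
  ... | no _    = contradiction gap≡0 λ ()

  gap-sym : ∀ x y → gap x y ≡ gap y x
  gap-sym x y with x ~? y | y ~? x
  ... | yes _   | yes _   = refl
  ... | no _    | no _    = refl
  ... | yes x~y | no y≁x  = contradiction (~-sym x~y) y≁x
  ... | no x≁y  | yes y~x = contradiction (~-sym y~x) x≁y

  breaks : List V → ℕ
  breaks []          = 0
  breaks (x ∷ [])    = 0
  breaks (x ∷ y ∷ t) = gap x y + breaks (y ∷ t)

  breaks-++ : ∀ xs y ys → breaks (xs ++ y ∷ ys) ≡ breaks (xs ∷ʳ y) + breaks (y ∷ ys)
  breaks-++ []             y ys = refl
  breaks-++ (x ∷ [])       y ys = cong (_+ breaks (y ∷ ys)) (sym (+-identityʳ (gap x y)))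
  breaks-++ (x ∷ x′ ∷ xs) y ys =
    trans (cong (gap x x′ +_) (breaks-++ (x′ ∷ xs) y ys)) (sym (+-assoc (gap x x′) _ _))

  breaks-reverse : ∀ xs → breaks (reverse xs) ≡ breaks xs
  breaks-reverse []          = refl
  breaks-reverse (x ∷ [])    = refl
  breaks-reverse (x ∷ y ∷ t) = begin
    breaks (reverse (x ∷ y ∷ t))           ≡⟨ cong breaks reverse-xyt ⟩
    breaks (reverse t ++ y ∷ [ x ])        ≡⟨ breaks-++ (reverse t) y [ x ] ⟩
    breaks (reverse t ∷ʳ y) + (gap y x + 0) ≡⟨ cong₂ _+_ (cong breaks (sym (unfold-reverse y t))) (+-identityʳ _) ⟩
    breaks (reverse (y ∷ t)) + gap y x      ≡⟨ cong (_+ gap y x) (breaks-reverse (y ∷ t)) ⟩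
    breaks (y ∷ t) + gap y x               ≡⟨ +-comm _ (gap y x) ⟩
    gap y x + breaks (y ∷ t)               ≡⟨ cong (_+ breaks (y ∷ t)) (gap-sym y x) ⟩
    gap x y + breaks (y ∷ t)               ∎
    where
    open ≡-Reasoning
    reverse-xyt : reverse (x ∷ y ∷ t) ≡ reverse t ++ y ∷ [ x ]
    reverse-xyt = trans (unfold-reverse x (y ∷ t))
      (trans (cong (_∷ʳ x) (unfold-reverse y t)) (++-assoc (reverse t) [ y ] [ x ]))

  cycleBreaks : List V → ℕ
  cycleBreaks []       = 0
  cycleBreaks (x ∷ xs) = breaks (x ∷ xs ∷ʳ x)

  cycleBreaks-rotate₁ : ∀ x xs → cycleBreaks (x ∷ xs) ≡ cycleBreaks (xs ∷ʳ x)
  cycleBreaks-rotate₁ x []      = refl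
  cycleBreaks-rotate₁ x (y ∷ t) = begin
    gap x y + breaks (y ∷ t ∷ʳ x)              ≡⟨ +-comm (gap x y) _ ⟩
    breaks (y ∷ t ∷ʳ x) + gap x y              ≡⟨ cong (breaks (y ∷ t ∷ʳ x) +_) (sym (+-identityʳ (gap x y))) ⟩
    breaks (y ∷ t ∷ʳ x) + breaks (x ∷ [ y ])   ≡⟨ breaks-++ (y ∷ t) x [ y ] ⟨
    breaks (y ∷ t ++ x ∷ [ y ])                ≡⟨ cong (λ xs → breaks (y ∷ xs)) (++-assoc t [ x ] [ y ]) ⟨
    breaks (y ∷ (t ∷ʳ x) ∷ʳ y)                 ∎
    where open ≡-Reasoning

  cycleBreaks-rotate : ∀ xs ys → cycleBreaks (xs ++ ys) ≡ cycleBreaks (ys ++ xs)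
  cycleBreaks-rotate []       ys = cong cycleBreaks (sym (++-identityʳ ys))
  cycleBreaks-rotate (x ∷ xs) ys = begin
    cycleBreaks (x ∷ xs ++ ys)        ≡⟨ cycleBreaks-rotate₁ x (xs ++ ys) ⟩
    cycleBreaks ((xs ++ ys) ∷ʳ x)     ≡⟨ cong cycleBreaks (++-assoc xs ys [ x ]) ⟩
    cycleBreaks (xs ++ ys ∷ʳ x)       ≡⟨ cycleBreaks-rotate xs (ys ∷ʳ x) ⟩
    cycleBreaks ((ys ∷ʳ x) ++ xs)     ≡⟨ cong cycleBreaks (++-assoc ys [ x ] xs) ⟩
    cycleBreaks (ys ++ x ∷ xs)        ∎
    where open ≡-Reasoning

  breaks≡0⇒Linked : ∀ xs → breaks xs ≡ 0 → Linked _~_ xs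
  breaks≡0⇒Linked []          _ = []
  breaks≡0⇒Linked (x ∷ [])    _ = [-]
  breaks≡0⇒Linked (x ∷ y ∷ t) b≡0 =
    gap≡0⇒adjacent (m+n≡0⇒m≡0 (gap x y) b≡0) ∷ breaks≡0⇒Linked (y ∷ t) (m+n≡0⇒n≡0 (gap x y) b≡0)

  -- Reversing the segment v₂ … w trades the break v₁v₂ for the edge v₁w and the pair ww′
  -- for the edge v₂w′, while the breaks inside the segment are unchanged.
  reversal-breaks< : ∀ {v₁ v₂ w w′} P R → ¬ v₁ ~ v₂ → v₁ ~ w → v₂ ~ w′ →
                     breaks (v₁ ∷ reverse (v₂ ∷ P ∷ʳ w) ++ w′ ∷ R) <
                     breaks (v₁ ∷ v₂ ∷ P ++ w ∷ w′ ∷ R)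
  reversal-breaks< {v₁} {v₂} {w} {w′} P R v₁≁v₂ v₁~w v₂~w′ = begin-strict
    breaks (v₁ ∷ reverse segment ++ T)              ≡⟨ cong (λ xs → breaks (v₁ ∷ xs ++ T)) reverse-segment ⟩
    breaks (v₁ ∷ (w ∷ reverse P ∷ʳ v₂) ++ T)        ≡⟨ cong (λ xs → breaks (v₁ ∷ w ∷ xs)) reassociate ⟩
    gap v₁ w + breaks (w ∷ reverse P ++ v₂ ∷ T)     ≡⟨ cong (_+ breaks (w ∷ reverse P ++ v₂ ∷ T)) (gap-adjacent v₁~w) ⟩
    breaks ((w ∷ reverse P) ++ v₂ ∷ T)              ≡⟨ breaks-++ (w ∷ reverse P) v₂ T ⟩
    breaks (w ∷ reverse P ∷ʳ v₂) + breaks (v₂ ∷ T)  ≡⟨ cong₂ _+_ reversed (cong (_+ breaks T) (gap-adjacent v₂~w′)) ⟩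
    breaks segment + breaks T                       ≤⟨ +-monoʳ-≤ (breaks segment) (m≤n+m _ (gap w w′)) ⟩
    breaks segment + breaks (w ∷ T)                 <⟨ n<1+n _ ⟩
    1 + (breaks segment + breaks (w ∷ T))           ≡⟨ cong₂ _+_ (gap-nonadjacent v₁≁v₂) (breaks-++ (v₂ ∷ P) w T) ⟨
    breaks (v₁ ∷ v₂ ∷ P ++ w ∷ T)                   ∎
    where
    open ≤-Reasoning
    segment = v₂ ∷ P ∷ʳ w
    T       = w′ ∷ R
    reverse-segment : reverse segment ≡ w ∷ reverse P ∷ʳ v₂
    reverse-segment = trans (reverse-++ (v₂ ∷ P) [ w ]) (cong (w ∷_) (unfold-reverse v₂ P))
    reassociate : (reverse P ∷ʳ v₂) ++ T ≡ reverse P ++ v₂ ∷ T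
    reassociate = ++-assoc (reverse P) [ v₂ ] T
    reversed : breaks (w ∷ reverse P ∷ʳ v₂) ≡ breaks segment
    reversed = trans (cong breaks (sym reverse-segment)) (breaks-reverse segment)

  breaks-closing : ∀ x t s → 0 < breaks (x ∷ t ∷ʳ s) →
                   (∃[ A ] ∃[ a ] ∃[ b ] ∃[ B ] x ∷ t ≡ A ++ a ∷ b ∷ B × ¬ a ~ b) ⊎
                   (∃[ A ] ∃[ a ] x ∷ t ≡ A ∷ʳ a × ¬ a ~ s)
  breaks-closing x [] s 0<b with x ~? s
  ... | yes _   = contradiction 0<b λ ()
  ... | no x≁s  = inj₂ ([] , x , refl , x≁s)
  breaks-closing x (y ∷ t) s 0<b with x ~? y
  ... | no x≁y  = inj₁ ([] , x , y , t , refl , x≁y)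
  ... | yes _ with breaks-closing y t s 0<b
  ...   | inj₁ (A , a , b , B , eq , a≁b) = inj₁ (x ∷ A , a , b , B , cong (x ∷_) eq , a≁b)
  ...   | inj₂ (A , a , eq , a≁s)         = inj₂ (x ∷ A , a , cong (x ∷_) eq , a≁s)

  rotate-to-break : ∀ L → 0 < cycleBreaks L →
                    ∃[ v₁ ] ∃[ v₂ ] ∃[ M ] v₁ ∷ v₂ ∷ M ↭ L ×
                      cycleBreaks (v₁ ∷ v₂ ∷ M) ≡ cycleBreaks L × ¬ v₁ ~ v₂
  rotate-to-break (x ∷ t) 0<b with breaks-closing x t x 0<b
  ... | inj₁ (A , a , b , B , eq , a≁b) =
    a , b , B ++ A ,
    subst (a ∷ b ∷ B ++ A ↭_) (sym eq) (++-comm (a ∷ b ∷ B) A) ,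
    trans (cycleBreaks-rotate (a ∷ b ∷ B) A) (cong cycleBreaks (sym eq)) ,
    a≁b
  ... | inj₂ ([] , a , refl , a≁a) = contradiction ~-refl a≁a
  ... | inj₂ (x ∷ A , a , refl , a≁x) =
    a , x , A , ++-comm [ a ] (x ∷ A) , cycleBreaks-rotate [ a ] (x ∷ A) , a≁x

  degreeIn : V → List V → ℕ
  degreeIn v xs = length (filter (v ~?_) xs)

  degreeIn-resp-↭ : ∀ v {xs ys} → xs ↭ ys → degreeIn v xs ≡ degreeIn v ys
  degreeIn-resp-↭ v xs↭ys = ↭-length (filter-↭ (v ~?_) xs↭ys)

  degreeIn-∷ : ∀ {v xs ys} → v ∷ xs ↭ ys → degreeIn v ys ≡ suc (degreeIn v xs)
  degreeIn-∷ {v} v∷xs↭ys =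
    trans (degreeIn-resp-↭ v (↭-sym v∷xs↭ys)) (cong length (filter-accept (v ~?_) ~-refl))

  -- Degrees count the loop at v, so this is Dirac's condition deg v ≥ |U| / 2.
  module _ (U : List V) (dense : ∀ v → length U + 2 ≤ 2 * degreeIn v U) where

    reversal-step : ∀ {v₁ v₂ M} → v₁ ∷ v₂ ∷ M ↭ U → ¬ v₁ ~ v₂ →
                    ∃[ L ] L ↭ U × cycleBreaks L < cycleBreaks (v₁ ∷ v₂ ∷ M)
    reversal-step {v₁} {v₂} {M} L↭U v₁≁v₂
      with consecutive-pigeonhole (v₁ ~?_) (v₂ ~?_) v₂ M enough-neighbours
      where
      d₁ = degreeIn v₁ (v₂ ∷ M)
      d₂ = degreeIn v₂ M
      deg-v₁ : degreeIn v₁ U ≡ suc d₁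
      deg-v₁ = degreeIn-∷ L↭U
      deg-v₂ : degreeIn v₂ U ≡ suc d₂
      deg-v₂ = trans (degreeIn-∷ (↭-trans (↭-swap v₂ v₁ ↭-refl) L↭U))
                     (cong (suc ∘ length) (filter-reject (v₂ ~?_) (v₁≁v₂ ∘ ~-sym)))
      enough-neighbours : length (v₂ ∷ M) < d₁ + d₂
      enough-neighbours = s≤s⁻¹ (s≤s⁻¹ (begin
        2 + length (v₁ ∷ v₂ ∷ M)       ≡⟨ +-comm 2 (length (v₁ ∷ v₂ ∷ M)) ⟩
        length (v₁ ∷ v₂ ∷ M) + 2       ≡⟨ cong (_+ 2) (↭-length L↭U) ⟩
        length U + 2                    ≤⟨ ≤-half-sum {x = degreeIn v₁ U} (dense v₁) (dense v₂) ⟩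
        degreeIn v₁ U + degreeIn v₂ U  ≡⟨ cong₂ _+_ deg-v₁ deg-v₂ ⟩
        suc d₁ + suc d₂                 ≡⟨ cong suc (+-suc d₁ d₂) ⟩
        2 + (d₁ + d₂)                   ∎))
        where open ≤-Reasoning
    ... | [] , _ , _ , _ , refl , v₁~v₂ , _ = contradiction v₁~v₂ v₁≁v₂
    ... | _ ∷ P , w , w′ , B , refl , v₁~w , v₂~w′ =
      v₁ ∷ reverse segment ++ w′ ∷ B ,
      ↭-trans (prep v₁ reversed↭) L↭U ,
      subst₂ _<_ (cong (λ xs → breaks (v₁ ∷ xs)) (sym (++-assoc (reverse segment) (w′ ∷ B) [ v₁ ])))
                 (cong (λ xs → breaks (v₁ ∷ v₂ ∷ xs)) (sym (++-assoc P (w ∷ w′ ∷ B) [ v₁ ])))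
                 (reversal-breaks< P (B ∷ʳ v₁) v₁≁v₂ v₁~w v₂~w′)
      where
      segment = v₂ ∷ P ∷ʳ w
      reversed↭ : reverse segment ++ w′ ∷ B ↭ v₂ ∷ P ++ w ∷ w′ ∷ B
      reversed↭ = ↭-trans (++⁺ʳ (w′ ∷ B) (↭-reverse segment))
                          (↭-reflexive (cong (v₂ ∷_) (++-assoc P [ w ] (w′ ∷ B))))

    shorten : ∀ {L} → L ↭ U → 0 < cycleBreaks L → ∃[ L′ ] L′ ↭ U × cycleBreaks L′ < cycleBreaks L
    shorten {L} L↭U 0<b =
      let v₁ , v₂ , M , rotated↭L , same-breaks , v₁≁v₂ = rotate-to-break L 0<b
          L′ , L′↭U , fewer = reversal-step (↭-trans rotated↭L L↭U) v₁≁v₂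
      in  L′ , L′↭U , subst (cycleBreaks L′ <_) same-breaks fewer

    descend : ∀ k {L} → L ↭ U → cycleBreaks L ≤ k → ∃[ L′ ] L′ ↭ U × cycleBreaks L′ ≡ 0
    descend zero    {L} L↭U b≤0 = L , L↭U , n≤0⇒n≡0 b≤0
    descend (suc k) {L} L↭U b≤k with cycleBreaks L ≟ 0
    ... | yes b≡0 = L , L↭U , b≡0
    ... | no  b≢0 =
      let L′ , L′↭U , fewer = shorten L↭U (n≢0⇒n>0 b≢0)
      in  descend k L′↭U (s≤s⁻¹ (≤-trans fewer b≤k))

    hamiltonian-cycle : ∃[ L ] L ↭ U × CyclicallyLinked _~_ L
    hamiltonian-cycle with descend (cycleBreaks U) ↭-refl ≤-refl
    ... | []    , L↭U , _   = [] , L↭U , _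
    ... | x ∷ t , L↭U , b≡0 = x ∷ t , L↭U , breaks≡0⇒Linked (x ∷ t ∷ʳ x) b≡0

toℕ-next : (i : Fin (suc m)) → toℕ (next i) ≡ suc (toℕ i) % suc m
toℕ-next i = toℕ-fromℕ< _

next-inject₁ : (j : Fin m) → next (inject₁ j) ≡ suc j
next-inject₁ {m} j = toℕ-injective (begin
  toℕ (next (inject₁ j))         ≡⟨ toℕ-next (inject₁ j) ⟩
  suc (toℕ (inject₁ j)) % suc m  ≡⟨ cong (λ k → suc k % suc m) (toℕ-inject₁ j) ⟩
  suc (toℕ j) % suc m            ≡⟨ m<n⇒m%n≡m (s≤s (toℕ<n j)) ⟩
  suc (toℕ j)                    ∎)
  where open ≡-Reasoning

next-fromℕ : ∀ m → next (fromℕ m) ≡ zero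
next-fromℕ m = toℕ-injective (begin
  toℕ (next (fromℕ m))         ≡⟨ toℕ-next (fromℕ m) ⟩
  suc (toℕ (fromℕ m)) % suc m  ≡⟨ cong (λ k → suc k % suc m) (toℕ-fromℕ m) ⟩
  suc m % suc m                ≡⟨ n%n≡0 (suc m) ⟩
  0                            ∎)
  where open ≡-Reasoning

Linked-tabulate-∷ʳ : ∀ {R : Rel A ℓ} (f : Fin (suc m) → A) {z} → Linked R (tabulate f ∷ʳ z) →
                     (∀ j → R (f (inject₁ j)) (f (suc j))) × R (f (fromℕ m)) z
Linked-tabulate-∷ʳ {m = zero}  f (r ∷ [-]) = (λ ()) , r
Linked-tabulate-∷ʳ {m = suc m} f (r ∷ rs)  =
  let steps , closing = Linked-tabulate-∷ʳ (f ∘ suc) rs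
  in  (λ { zero → r ; (suc j) → steps j }) , closing

CyclicallyLinked-tabulate : ∀ {R : Rel A ℓ} (f : Fin (suc m) → A) → CyclicallyLinked R (tabulate f) →
                            ∀ i → R (f i) (f (next i))
CyclicallyLinked-tabulate {m = m} {R = R} f cyc i with Linked-tabulate-∷ʳ f cyc | m ≟ toℕ i
... | _ , closing | yes m≡i =
  subst (λ j → R (f j) (f (next j))) (toℕ-injective (trans (toℕ-fromℕ m) m≡i))
        (subst (R (f (fromℕ m)) ∘ f) (sym (next-fromℕ m)) closing)
... | steps , _   | no m≢i  =
  subst (λ j → R (f j) (f (next j))) (inject₁-lower₁ i m≢i)
        (subst (R (f (inject₁ (lower₁ i m≢i))) ∘ f) (sym (next-inject₁ _)) (steps _))

index-unique : ∀ {x : A} {xs} → Unique xs → (p q : x List.∈ xs) → index p ≡ index q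
index-unique _          (here refl) (here refl) = refl
index-unique (x∉ ∷ _)   (here refl) (there q)   = contradiction q (All.All¬⇒¬Any x∉)
index-unique (x∉ ∷ _)   (there p)   (here refl) = contradiction p (All.All¬⇒¬Any x∉)
index-unique (_ ∷ uxs)  (there p)   (there q)   = cong suc (index-unique uxs p q)

index-∈-lookup : ∀ (xs : List A) i → index (∈-lookup {xs = xs} i) ≡ i
index-∈-lookup (x ∷ xs) zero    = refl
index-∈-lookup (x ∷ xs) (suc i) = cong suc (index-∈-lookup xs i)

tabulate-lookup-cast : ∀ (xs : List A) (eq : n ≡ length xs) → tabulate (lookup xs ∘ cast eq) ≡ xs
tabulate-lookup-cast {n = zero}  []       _  = refl
tabulate-lookup-cast {n = suc n} (x ∷ xs) eq = cong (x ∷_) (tabulate-lookup-cast xs (cong pred eq))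

enumeration⇒permutation : ∀ (L : List (Fin n)) → L ↭ allFin n →
                          ∃[ σ ] tabulate (σ ⟨$⟩ʳ_) ≡ L
enumeration⇒permutation {n} L L↭ = cast-id n≡∣L∣ ∘ₚ π , tabulate-lookup-cast L n≡∣L∣
  where
  n≡∣L∣ : n ≡ length L
  n≡∣L∣ = sym (trans (↭-length L↭) (length-tabulate id))
  complete : ∀ v → v List.∈ L
  complete v = ∈-resp-↭ (↭-sym L↭) (∈-allFin v)
  L-unique : Unique L
  L-unique = Unique-resp-↭ (setoid (Fin n)) (↭⇒↭ₛ (↭-sym L↭)) (allFin⁺ n)
  π : Permutation (length L) n
  π = permutation (lookup L) (index ∘ complete)
        (λ v → sym (lookup-index (complete v)))
        (λ i → trans (index-unique L-unique (complete (lookup L i)) (∈-lookup i)) (index-∈-lookup L i))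

-- The shadow graph of a hypergraph

length-filter-tabulate : ∀ {P : Pred A ℓ} (P? : U.Decidable P) (f : Fin n → A) →
                         length (filter P? (List.tabulate f)) ≡ ∣ Vec.tabulate (does ∘ P? ∘ f) ∣
length-filter-tabulate {n = zero}  P? f = refl
length-filter-tabulate {n = suc n} P? f with P? (f zero)
... | yes _ = cong suc (length-filter-tabulate P? (f ∘ suc))
... | no _  = length-filter-tabulate P? (f ∘ suc)

module _ {r n} (H : UniformHypergraph r n) where

  -- The 2-shadow of H; a vertex lying in some hyperedge is adjacent to itself.
  Adjacent : Rel (Fin n) 0ℓ
  Adjacent u w = Any (λ e → u ∈ e × w ∈ e) (edges H)

  adjacent? : Decidable Adjacent
  adjacent? u w = any? (λ e → u ∈? e ×-dec w ∈? e) (edges H)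

  adjacent-sym : Symmetric Adjacent
  adjacent-sym = Any.map swap

  edge⇒adjacent : ∀ {e u w} → e List.∈ edges H → u ∈ e → w ∈ e → Adjacent u w
  edge⇒adjacent e∈H u∈e w∈e = Any.map (λ { refl → u∈e , w∈e }) e∈H

  δ₁>⇒adjacent-refl : ∀ {d} → δ₁> H d → Reflexive Adjacent
  δ₁>⇒adjacent-refl δ> {v} =
    let e∈H , v∈e = ∈-filter⁻ (v ∈?_) {xs = edges H} (∈-lookup (fromℕ< (≤-<-trans z≤n (δ> v))))
    in  edge⇒adjacent e∈H v∈e v∈e

  neighbourhood : Fin n → Subset n
  neighbourhood v = Vec.tabulate (λ u → does (adjacent? v u))

  adjacent⇒∈neighbourhood : ∀ {v u} → Adjacent v u → u ∈ neighbourhood v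
  adjacent⇒∈neighbourhood {v} {u} v~u =
    lookup⇒[]= u _ (trans (lookup∘tabulate _ u) (dec-true (adjacent? v u) v~u))

degree≤C : ∀ {k n} (H : UniformHypergraph (suc k) n) v → degree H v ≤ ∣ neighbourhood H v - v ∣ C k
degree≤C {k} H v = length-links≤C v (neighbourhood H v) (filter⁺ (v ∈?_) (unique H)) (All.tabulate link)
  where
  link : ∀ {e} → e List.∈ filter (v ∈?_) (edges H) → v ∈ e × e ⊆ neighbourhood H v × ∣ e ∣ ≡ suc k
  link e∈ = let e∈H , v∈e = ∈-filter⁻ (v ∈?_) {xs = edges H} e∈ in
    v∈e , adjacent⇒∈neighbourhood H ∘ edge⇒adjacent H e∈H v∈e , All.lookup (uniform H) e∈H

dirac-condition : ∀ {k n} (H : UniformHypergraph (suc k) n) → δ₁> H ((⌈ n /2⌉ ∸ 1) C k) →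
                  ∀ v → length (allFin n) + 2 ≤ 2 * length (filter (adjacent? H v) (allFin n))
dirac-condition {k} {n} H δ> v = begin
  length (allFin n) + 2                        ≡⟨ cong (_+ 2) (length-tabulate id) ⟩
  n + 2                                        ≤⟨ n+2≤2*[1+⌈n/2⌉] n ⟩
  2 * suc ⌈ n /2⌉                              ≤⟨ *-monoʳ-≤ 2 (s≤s ⌈n/2⌉≤∣N-v∣) ⟩
  2 * suc ∣ N - v ∣                            ≡⟨ cong (2 *_) (suc∣p-x∣≡∣p∣ v∈N) ⟩
  2 * ∣ N ∣                                    ≡⟨ cong (2 *_) (length-filter-tabulate (adjacent? H v) id) ⟨
  2 * length (filter (adjacent? H v) (allFin n)) ∎
  where
  open ≤-Reasoning
  N = neighbourhood H v
  v∈N : v ∈ N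
  v∈N = adjacent⇒∈neighbourhood H (δ₁>⇒adjacent-refl H δ>)
  ⌈n/2⌉≤∣N-v∣ : ⌈ n /2⌉ ≤ ∣ N - v ∣
  ⌈n/2⌉≤∣N-v∣ = m∸1<n⇒m≤n (C-cancelˡ-< k (<-≤-trans (δ> v) (degree≤C H v)))

-- The hypotheses 3 ≤ r and r ≤ n serve only to rule out r = 0 and n = 0.
proposition1p1 : (r n : ℕ) → 3 ≤ r → r ≤ n → (H : UniformHypergraph r n) →
                   δ₁> H ((⌈ n /2⌉ ∸ 1) C (r ∸ 1)) → WeakHamiltonCycle H
proposition1p1 zero    _       ()  _  _ _
proposition1p1 (suc k) zero    _   () _ _
proposition1p1 (suc k) (suc m) _   _  H δ> =
  let L , L↭allFin , L-cycle = hamiltonian-cycle (allFin (suc m)) (dirac-condition H δ>)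
      σ , σ-lists-L         = enumeration⇒permutation L L↭allFin
  in  σ , CyclicallyLinked-tabulate (σ ⟨$⟩ʳ_)
            (subst (CyclicallyLinked (Adjacent H)) (sym σ-lists-L) L-cycle)
  where
  open Dirac (adjacent? H) (adjacent-sym H) (δ₁>⇒adjacent-refl H δ>)
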